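{- Let $q\ge2$ and $\beta\ge 2$ be integers and let $(a(n))_{n\in\mathbb{N}}$ be a $\beta$-recursive sequence with propagation function $g$. Let $n$ be an integer with base-$q$ expansion $n=\sum_{i=0}^N\epsilon_i(n)q^i=\varphi(\epsilon_N(n)\cdot\ldots\cdot\epsilon_1(n)\cdot\epsilon_0(n))$, where $N=T_q(n)$. If $n\ge q^{\beta-1}$, then $N\ge\beta-1$ and $$a(n)=a\Big(\varphi\big(\epsilon_N(n)\cdot\epsilon_{N-1}(n)\cdot\ldots\cdot\epsilon_{N-\beta+2}(n)\big)\Big)+\sum_{l=0}^{N-\beta+1}g\big(\epsilon_{l+\beta-1}(n)\cdot\ldots\cdot\epsilon_{l+1}(n)\cdot\epsilon_l(n)\big).$$ Moreover the word $\epsilon_N(n)\cdot\ldots\cdot\epsilon_{N-\beta+2}(n)$ has length $\beta-1$ and $\epsilon_N(n)\neq0$.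
   Context: Fix an integer $q\ge2$ and the alphabet $\mathcal{A}=\{0,\dots,q-1\}$. $\Sigma_k$ is the set of words of length $k$ over $\mathcal{A}$. Concatenation of words is written $\omega\cdot\omega'$. For a word $\omega$, its letters are indexed from right to left: $\omega=\epsilon_{|\omega|-1}(\omega)\cdots\epsilon_0(\omega)$, and $\varphi(\omega)=\sum_{i=0}^{|\omega|-1}\epsilon_i(\omega)q^i$. For $0\le j\le|\omega|$, $\overline{\omega}^j$ denotes the prefix (leftmost $j$ letters) of $\omega$. For an integer $n\ge1$, $\epsilon_i(n)$ are its base-$q$ digits and $T_q(n)=\lfloor\log n/\log q\rfloor$. A sequence $(a(n))_{n\in\mathbb{N}}$ of integers is $\beta$-recursive ($\beta\ge2$ an integer) if there is a map $g:\Sigma_\beta\to\mathbb{N}$ (its propagation function) such that (i) for all $n\ge1$ and all $\omega\in\Sigma_\beta$, $a(q^\beta n+\varphi(\omega))=a(q^{\beta-1}n+\varphi(\overline{\omega}^{\beta-1}))+g(\omega)$; and (ii) for all $\omega\in\Sigma_\beta$ whose leftmost letter $\overline{\omega}^1$ is not $0$, $a(\varphi(\omega))=a(\varphi(\overline{\omega}^{\beta-1}))+g(\omega)$. -}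

module Defs where

open import Data.Nat using (ℕ; zero; suc; _+_; _*_; _∸_; _^_; _≤_; _≤ᵇ_; NonZero)
open import Data.Nat.Properties using (m^n≢0)
open import Data.Nat.DivMod using (_/_; _mod_)
open import Data.Fin using (Fin; toℕ)
open import Data.Vec using (Vec; []; _∷_; init)
open import Data.Integer using (ℤ; +_) renaming (_+_ to _+ℤ_)
open import Data.Product using (_×_)
open import Data.Bool using (if_then_else_)
open import Data.Empty using (⊥)
open import Relation.Binary.PropositionalEquality using (_≡_; _≢_)

-- A word of length k over {0,…,q-1}: a vector whose HEAD is the LEFTMOST letter
-- ε_{k-1}(ω), and whose last entry is ε_0(ω).
Word : ℕ → ℕ → Set
Word q k = Vec (Fin q) k

φ : {q k : ℕ} → Word q k → ℕ
φ {q} {zero}  []       = 0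
φ {q} {suc k} (x ∷ xs) = toℕ x * q ^ k + φ xs

prefix : {A : Set} {k : ℕ} → Vec A k → Vec A (k ∸ 1)
prefix []       = []
prefix (x ∷ xs) = init (x ∷ xs)

LeftmostNonZero : {q k : ℕ} → Word q k → Set
LeftmostNonZero []      = ⊥
LeftmostNonZero (x ∷ _) = toℕ x ≢ 0

IsRecursive : (q : ℕ) → (β : ℕ) → (ℕ → ℤ) → (Word q β → ℕ) → Set
IsRecursive q β a g =
  (∀ (n : ℕ) → 1 ≤ n → ∀ (ω : Word q β) →
     a (q ^ β * n + φ ω) ≡ a (q ^ (β ∸ 1) * n + φ (prefix ω)) +ℤ + g ω)
  × (∀ (ω : Word q β) → LeftmostNonZero ω →
     a (φ ω) ≡ a (φ (prefix ω)) +ℤ + g ω)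

digit : (q : ℕ) .{{_ : NonZero q}} → ℕ → ℕ → Fin q
digit q n i = ((n / q ^ i) {{m^n≢0 q i}}) mod q


-- T_q(n) = ⌊log n / log q⌋, computed by repeated division (fuel = n suffices for q ≥ 2)
logAux : (q : ℕ) .{{_ : NonZero q}} → ℕ → ℕ → ℕ
logAux q zero    n = 0
logAux q (suc f) n = if q ≤ᵇ n then suc (logAux q f (n / q)) else 0

T : (q : ℕ) .{{_ : NonZero q}} → ℕ → ℕ
T q n = logAux q n n

digitWord : (q : ℕ) .{{_ : NonZero q}} → ℕ → (l k : ℕ) → Word q k
digitWord q n l zero    = []
digitWord q n l (suc k) = digit q n (l + k) ∷ digitWord q n l k

sumTo : ℕ → (ℕ → ℕ) → ℕ
sumTo zero    f = 0
sumTo (suc m) f = sumTo m f + f m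

{-# OPTIONS --safe #-}
-- Writing n = q^β m + φ(ω) with ω its last β digits, the recursion (i) (or (ii) when m = 0)
-- turns a(n) into a(⌊n / q⌋) + g(ω): deleting the last digit of n costs the propagation
-- value of its last β digits. Iterating while at least β digits remain telescopes a(n) into
-- the value of a at its leading β - 1 digits plus the sum of g over all windows of β
-- consecutive digits.
module Submission where

open import Defs
open import Data.Nat using (ℕ; zero; suc; _+_; _*_; _∸_; _^_; _≤_; _<_; _≤ᵇ_; s≤s; z≤n; s≤s⁻¹; NonZero; >-nonZero)
open import Data.Nat.Properties
open import Data.Nat.DivMod
open import Data.Nat.Tactic.RingSolver using (solve-∀)
open import Data.Fin using (toℕ)
open import Data.Fin.Properties using (toℕ-fromℕ<)
open import Data.Vec using (_∷_)
open import Data.Integer using (ℤ; +_) renaming (_+_ to _+ℤ_)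
import Data.Integer.Properties as ℤ
open import Data.Product using (_×_; _,_; proj₁; proj₂)
open import Data.Bool using (true; false)
open import Data.Empty using (⊥-elim)
open import Relation.Nullary using (yes; no)
open import Relation.Nullary.Reflects using (ofʸ; ofⁿ)
open import Relation.Binary.PropositionalEquality

module BaseExpansion (q : ℕ) {{_ : NonZero q}} where

  q^≢0 : ∀ i → NonZero (q ^ i)
  q^≢0 i = m^n≢0 q i

  infixl 7 _/q^_
  _/q^_ : ℕ → ℕ → ℕ
  n /q^ i = (n / q ^ i) {{q^≢0 i}}

  /q^-/q^ : ∀ n i j → n /q^ i /q^ j ≡ n /q^ (i + j)
  /q^-/q^ n i j = trans (m/n/o≡m/[n*o] n (q ^ i) (q ^ j)) (/-congʳ (sym (^-distribˡ-+-* q i j)))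
    where instance
      _ = q^≢0 i
      _ = q^≢0 j
      _ = q^≢0 (i + j)
      _ = m*n≢0 (q ^ i) (q ^ j)

  /q^-/q : ∀ n i → n /q^ i / q ≡ n /q^ suc i
  /q^-/q n i = trans (m/n/o≡m/[n*o] n (q ^ i) q) (/-congʳ (*-comm (q ^ i) q))
    where instance
      _ = q^≢0 i
      _ = q^≢0 (suc i)
      _ = m*n≢0 (q ^ i) q

  q^≤⇒q^≤/q^ : ∀ {n} i j → q ^ (i + j) ≤ n → q ^ i ≤ n /q^ j
  q^≤⇒q^≤/q^ {n} i j h = subst (_≤ n /q^ j) (m*n/n≡m (q ^ i) (q ^ j) {{q^≢0 j}})
    (/-monoˡ-≤ (q ^ j) {{q^≢0 j}} (subst (_≤ n) (^-distribˡ-+-* q i j) h))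

  toℕ-digit : ∀ n i → toℕ (digit q n i) ≡ n /q^ i % q
  toℕ-digit n i = toℕ-fromℕ< (m%n<n (n /q^ i) q)

  digit-/q^ : ∀ n k i → digit q (n /q^ k) i ≡ digit q n (k + i)
  digit-/q^ n k i = cong (_mod q) (/q^-/q^ n k i)

  digitWord-/q^ : ∀ n k l j → digitWord q (n /q^ k) l j ≡ digitWord q n (k + l) j
  digitWord-/q^ n k l zero    = refl
  digitWord-/q^ n k l (suc j) =
    cong₂ _∷_ (trans (digit-/q^ n k (l + j)) (cong (digit q n) (sym (+-assoc k l j))))
              (digitWord-/q^ n k l j)

  prefix-digitWord : ∀ n l k → prefix (digitWord q n l (suc k)) ≡ digitWord q n (suc l) k
  prefix-digitWord n l zero    = refl
  prefix-digitWord n l (suc k) = cong₂ _∷_ (cong (digit q n) (+-suc l k)) (prefix-digitWord n l k)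

  leading-digit≢0 : ∀ {n} j → q ^ j ≤ n → n < q ^ suc j → toℕ (digit q n j) ≢ 0
  leading-digit≢0 {n} j lo hi digit≡0 = <⇒≢ (m≥n⇒m/n>0 {{q^≢0 j}} lo) (sym (begin
      n /q^ j       ≡⟨ m<n⇒m%n≡m (m<n*o⇒m/o<n {o = q ^ j} {{q^≢0 j}} hi) ⟨
      n /q^ j % q   ≡⟨ toℕ-digit n j ⟨
      toℕ (digit q n j) ≡⟨ digit≡0 ⟩
      0             ∎))
    where open ≡-Reasoning

  /q^-expansion : ∀ n l k → n /q^ l ≡ q ^ k * (n /q^ (l + k)) + φ (digitWord q n l k)
  /q^-expansion n l zero    = begin
      n /q^ l               ≡⟨ cong (n /q^_) (+-identityʳ l) ⟨
      n /q^ (l + 0)         ≡⟨ *-identityˡ _ ⟨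
      1 * (n /q^ (l + 0))   ≡⟨ +-identityʳ _ ⟨
      1 * (n /q^ (l + 0)) + 0 ∎
    where open ≡-Reasoning
  /q^-expansion n l (suc k) = begin
      n /q^ l                     ≡⟨ /q^-expansion n l k ⟩
      q ^ k * Y + P               ≡⟨ cong (λ y → q ^ k * y + P) Y≡d+Z*q ⟩
      q ^ k * (d + Z * q) + P     ≡⟨ regroup (q ^ k) d Z q P ⟩
      q * q ^ k * Z + (d * q ^ k + P) ∎
    where
      open ≡-Reasoning
      Y = n /q^ (l + k)
      Z = n /q^ (l + suc k)
      d = toℕ (digit q n (l + k))
      P = φ (digitWord q n l k)
      Y≡d+Z*q : Y ≡ d + Z * q
      Y≡d+Z*q = trans (m≡m%n+[m/n]*n Y q)
        (cong₂ _+_ (sym (toℕ-digit n (l + k)))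
                   (cong (_* q) (trans (/q^-/q n (l + k)) (cong (n /q^_) (sym (+-suc l k))))))
      regroup : ∀ K d Z q P → K * (d + Z * q) + P ≡ q * K * Z + (d * K + P)
      regroup = solve-∀

  φ-digitWord : ∀ n l k → n < q ^ (l + k) → φ (digitWord q n l k) ≡ n /q^ l
  φ-digitWord n l k n<q^ = sym (begin
      n /q^ l                                ≡⟨ /q^-expansion n l k ⟩
      q ^ k * (n /q^ (l + k)) + φ w          ≡⟨ cong (λ m → q ^ k * m + φ w) (m<n⇒m/n≡0 {{q^≢0 (l + k)}} n<q^) ⟩
      q ^ k * 0 + φ w                        ≡⟨ cong (_+ φ w) (*-zeroʳ (q ^ k)) ⟩
      φ w                                    ∎)
    where
      open ≡-Reasoning
      w = digitWord q n l k

module Logarithm (q : ℕ) {{_ : NonZero q}} (1<q : 1 < q) where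

  logAux-bounds : ∀ fuel n → 1 ≤ n → n ≤ fuel →
    q ^ logAux q fuel n ≤ n × n < q ^ suc (logAux q fuel n)
  logAux-bounds zero       n 1≤n n≤0 = ⊥-elim (<⇒≱ 1≤n n≤0)
  logAux-bounds (suc fuel) n 1≤n n≤fuel with q ≤ᵇ n | ≤ᵇ-reflects-≤ q n
  ... | false | ofⁿ q≰n = 1≤n , subst (n <_) (sym (*-identityʳ q)) (≰⇒> q≰n)
  ... | true  | ofʸ q≤n = lower , upper
    where
      L = logAux q fuel (n / q)
      bounds : q ^ L ≤ n / q × n / q < q ^ suc L
      bounds = logAux-bounds fuel (n / q) (m≥n⇒m/n>0 q≤n)
        (s≤s⁻¹ (<-≤-trans (m/n<m n q {{>-nonZero 1≤n}} 1<q) n≤fuel))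
      lower : q ^ suc L ≤ n
      lower = subst (_≤ n) (*-comm (q ^ L) q) (≤-trans (*-monoˡ-≤ q (proj₁ bounds)) (m/n*n≤m n q))
      upper : n < q ^ suc (suc L)
      upper = subst (n <_) (*-comm (q ^ suc L) q) (begin-strict
        n                   ≡⟨ m≡m%n+[m/n]*n n q ⟩
        n % q + (n / q) * q <⟨ +-monoˡ-< ((n / q) * q) (m%n<n n q) ⟩
        q + (n / q) * q     ≤⟨ *-monoˡ-≤ q (proj₂ bounds) ⟩
        q ^ suc L * q       ∎)
        where open ≤-Reasoning

  T-bounds : ∀ {n} → 1 ≤ n → q ^ T q n ≤ n × n < q ^ suc (T q n)
  T-bounds {n} 1≤n = logAux-bounds n n 1≤n ≤-refl

  ^-cancelʳ-< : ∀ {i j} → q ^ i < q ^ j → i < j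
  ^-cancelʳ-< q^i<q^j = ≰⇒> (λ j≤i → <⇒≱ q^i<q^j (^-monoʳ-≤ q j≤i))

module Telescope {q b : ℕ} {{_ : NonZero q}} {a : ℕ → ℤ} {g : Word q (suc b) → ℕ}
                 (rec : IsRecursive q (suc b) a g) where

  open BaseExpansion q

  recursive-step : ∀ {n} → q ^ b ≤ n → a n ≡ a (n /q^ 1) +ℤ + g (digitWord q n 0 (suc b))
  recursive-step {n} q^b≤n with n <? q ^ suc b
  ... | yes n<q^β = begin
      a n                       ≡⟨ cong a (trans (sym (n/1≡n n)) (sym (φ-digitWord n 0 (suc b) n<q^β))) ⟩
      a (φ ω)                   ≡⟨ proj₂ rec ω (leading-digit≢0 b q^b≤n n<q^β) ⟩
      a (φ (prefix ω)) +ℤ + g ω ≡⟨ cong (λ w → a (φ w) +ℤ + g ω) (prefix-digitWord n 0 b) ⟩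
      a (φ (digitWord q n 1 b)) +ℤ + g ω ≡⟨ cong (λ m → a m +ℤ + g ω) (φ-digitWord n 1 b n<q^β) ⟩
      a (n /q^ 1) +ℤ + g ω      ∎
    where
      open ≡-Reasoning
      ω = digitWord q n 0 (suc b)
  ... | no n≮q^β = begin
      a n                       ≡⟨ cong a (trans (sym (n/1≡n n)) (/q^-expansion n 0 (suc b))) ⟩
      a (q ^ suc b * m + φ ω)   ≡⟨ proj₁ rec m (m≥n⇒m/n>0 {{q^≢0 (suc b)}} (≮⇒≥ n≮q^β)) ω ⟩
      a (q ^ b * m + φ (prefix ω)) +ℤ + g ω ≡⟨ cong (λ w → a (q ^ b * m + φ w) +ℤ + g ω) (prefix-digitWord n 0 b) ⟩
      a (q ^ b * m + φ (digitWord q n 1 b)) +ℤ + g ω ≡⟨ cong (λ m → a m +ℤ + g ω) (/q^-expansion n 1 b) ⟨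
      a (n /q^ 1) +ℤ + g ω      ∎
    where
      open ≡-Reasoning
      ω = digitWord q n 0 (suc b)
      m = n /q^ suc b

  recursive-telescope : ∀ k {n} → q ^ (b + k) ≤ n →
    a n ≡ a (n /q^ suc k) +ℤ + sumTo (suc k) (λ l → g (digitWord q n l (suc b)))
  recursive-telescope zero    h = recursive-step (subst (λ i → q ^ i ≤ _) (+-identityʳ b) h)
  recursive-telescope (suc k) {n} h = begin
      a n                                   ≡⟨ recursive-telescope k q^[b+k]≤n ⟩
      a m +ℤ + S                            ≡⟨ cong (_+ℤ + S) (recursive-step (q^≤⇒q^≤/q^ b (suc k) h)) ⟩
      (a (m /q^ 1) +ℤ + g (digitWord q m 0 (suc b))) +ℤ + S
                                            ≡⟨ cong₂ (λ i w → (a i +ℤ + g w) +ℤ + S) m/q≡ window≡ ⟩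
      (A +ℤ + G) +ℤ + S                     ≡⟨ ℤ.+-assoc A (+ G) (+ S) ⟩
      A +ℤ (+ G +ℤ + S)                     ≡⟨ cong (A +ℤ_) (trans (ℤ.+-comm (+ G) (+ S)) (sym (ℤ.pos-+ S G))) ⟩
      A +ℤ + (S + G)                        ∎
    where
      open ≡-Reasoning
      m = n /q^ suc k
      A = a (n /q^ suc (suc k))
      G = g (digitWord q n (suc k) (suc b))
      S = sumTo (suc k) (λ l → g (digitWord q n l (suc b)))
      q^[b+k]≤n : q ^ (b + k) ≤ n
      q^[b+k]≤n = ≤-trans (^-monoʳ-≤ q (+-monoʳ-≤ b (n≤1+n k))) h
      m/q≡ : m /q^ 1 ≡ n /q^ suc (suc k)
      m/q≡ = trans (/q^-/q^ n (suc k) 1) (cong (n /q^_) (+-comm (suc k) 1))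
      window≡ : digitWord q m 0 (suc b) ≡ digitWord q n (suc k) (suc b)
      window≡ = trans (digitWord-/q^ n (suc k) 0 (suc b))
                      (cong (λ l → digitWord q n l (suc b)) (+-identityʳ (suc k)))

window-count : ∀ b N → b ≤ N → N + 2 ∸ suc b ≡ suc (N ∸ b)
window-count b N b≤N = begin
    N + 2 ∸ suc b ≡⟨ cong (_∸ suc b) (+-suc N 1) ⟩
    N + 1 ∸ b     ≡⟨ +-∸-comm 1 b≤N ⟩
    N ∸ b + 1     ≡⟨ +-comm (N ∸ b) 1 ⟩
    suc (N ∸ b)   ∎
  where open ≡-Reasoning

proposition1 : (q : ℕ) {{_ : NonZero q}} → 2 ≤ q → (β : ℕ) → 2 ≤ β →
    (a : ℕ → ℤ) (g : Word q β → ℕ) → IsRecursive q β a g →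
    (n : ℕ) → q ^ (β ∸ 1) ≤ n →
    (β ∸ 1 ≤ T q n)
    × (a n ≡ a (φ (digitWord q n (T q n + 2 ∸ β) (β ∸ 1)))
             +ℤ + sumTo (T q n + 2 ∸ β) (λ l → g (digitWord q n l β)))
    × (toℕ (digit q n (T q n)) ≢ 0)
proposition1 q q≥2 (suc b@(suc _)) (s≤s (s≤s z≤n)) a g rec n q^b≤n =
  b≤N , expansion , leading-digit≢0 N q^N≤n n<q^N+1
  where
    open BaseExpansion q
    open Logarithm q q≥2
    open Telescope {a = a} {g = g} rec
    N = T q n
    bounds : q ^ N ≤ n × n < q ^ suc N
    bounds = T-bounds (≤-trans (m^n>0 q b) q^b≤n)
    q^N≤n : q ^ N ≤ n
    q^N≤n = proj₁ bounds
    n<q^N+1 : n < q ^ suc N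
    n<q^N+1 = proj₂ bounds
    b≤N : b ≤ N
    b≤N = s≤s⁻¹ (^-cancelʳ-< (≤-<-trans q^b≤n n<q^N+1))
    expansion : a n ≡ a (φ (digitWord q n (N + 2 ∸ suc b) b)) +ℤ + sumTo (N + 2 ∸ suc b) (λ l → g (digitWord q n l (suc b)))
    expansion rewrite window-count b N b≤N
                    | φ-digitWord n (suc (N ∸ b)) b (subst (λ i → n < q ^ suc i) (sym (m∸n+n≡m b≤N)) n<q^N+1)
      = recursive-telescope (N ∸ b) (subst (λ i → q ^ i ≤ n) (sym (m+[n∸m]≡n b≤N)) q^N≤n)
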